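{- Let $\pi\in S_n$ have LTR-max decomposition $\pi=M_1P_1M_2$ with $|M_2|=1$ (so $M_2$ consists of $n$ alone), and let $m_1=|M_1|$. Then $|q^{ -1}(\pi)|=C_{m_1}=\frac{1}{m_1+1}\binom{2m_1}{m_1}$.
   Context: $S_n$ is the set of permutations of $\{1,\dots,n\}$ in one-line notation. An entry $\pi_i$ is a left-to-right (LTR) maximum if $\pi_i>\pi_j$ for all $j<i$. The map $q:S_n\to S_n$ (the algorithm Queuesort, sorting with a queue allowing bypass): let $m_1,\dots,m_r$ be the LTR maxima of $\pi$ from left to right; for $i=r,\dots,1$ in this order, repeatedly swap $m_i$ with the entry immediately to its right as long as such an entry exists and is smaller than $m_i$; the result is $q(\pi)$. $q^{ -1}(\pi)=\{\sigma\in S_n: q(\sigma)=\pi\}$. The LTR-max decomposition $\pi=M_1P_1M_2$ means: $M_1$ is the maximal initial factor of consecutive LTR maxima, $P_1$ is a nonempty factor of non-LTR-maxima, and $M_2$ is the final factor consisting of LTR maxima, and these are all the LTR maxima. -}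

module Defs where

open import Data.Nat using (ℕ; zero; suc; _+_; _*_; _/_; _<ᵇ_; _≡ᵇ_)
open import Data.Nat.Combinatorics using (_C_)
open import Data.Bool using (if_then_else_)
open import Data.List using (List; []; _∷_; foldr; applyUpTo; length)
open import Data.List.Relation.Binary.Permutation.Propositional using (_↭_)

-- S_n : one-line notation lists that are rearrangements of [1,...,n]
IsPerm : ℕ → List ℕ → Set
IsPerm n σ = σ ↭ applyUpTo suc n

-- left-to-right maxima, listed from left to right (entries are ≥ 1, so start with 0)
ltrMaxGo : ℕ → List ℕ → List ℕ
ltrMaxGo m [] = []
ltrMaxGo m (x ∷ xs) = if m <ᵇ x then x ∷ ltrMaxGo x xs else ltrMaxGo m xs

ltrMaxima : List ℕ → List ℕ
ltrMaxima = ltrMaxGo 0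

bubble : ℕ → List ℕ → List ℕ
bubble x [] = x ∷ []
bubble x (y ∷ ys) = if y <ᵇ x then y ∷ bubble x ys else x ∷ y ∷ ys

moveVal : ℕ → List ℕ → List ℕ
moveVal v [] = []
moveVal v (y ∷ ys) = if y ≡ᵇ v then bubble v ys else y ∷ moveVal v ys

-- Queuesort: process the LTR maxima m_r, ..., m_1 (rightmost first)
q : List ℕ → List ℕ
q σ = foldr moveVal σ (ltrMaxima σ)

catalan : ℕ → ℕ
catalan m = ((2 * m) C m) / suc m

-- Read from left to right, Queuesort bubbles each new left-to-right maximum into the already
-- sorted remainder.  Its fibres can therefore be enumerated by undoing one step at a time: a
-- preimage starts either with an entry that is not a new maximum, or with a new maximum that was
-- bubbled into the rest.  For π = s a P n with s a increasing and P nonempty and below a, the ways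
-- to undo a bubble are explicit: the moved entry is an entry of s or n, since a is larger than the
-- entry after it and an entry of P could not have passed a.  Counting the preimages of l r a P n
-- under Queuesort with current maximum m, where l lies below m and r above it, both ways of
-- peeling off the first entry reproduce the recurrence of the ballot numbers, which gives
-- ballot (|r| + 1) (|l| + |r| + 1); for l empty and r = s this is ballot |M₁| |M₁| = C_|M₁|.

module Submission where

open import Defs
open import Data.Bool using (true; false; if_then_else_; T)
open import Data.List using (List; []; _∷_; _++_; length; map; filter; foldr; applyUpTo; initLast; _∷ʳ′_)
open import Data.List.Properties
  using (length-++; length-map; length-++-sucʳ; ++-assoc; ++-identityʳ; ∷-injective; ∷-injectiveˡ; ∷-injectiveʳ;
         filter-accept; filter-reject; filter-all; filter-none; filter-++)
open import Data.List.Membership.Propositional using (_∈_; _∉_)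
open import Data.List.Membership.Propositional.Properties using (∈-++⁺ˡ; ∈-++⁺ʳ; ∈-++⁻; ∈-map⁺; ∈-map⁻; ∈-filter⁺; ∈-filter⁻)
open import Data.List.Relation.Binary.Disjoint.Propositional using (Disjoint)
open import Data.List.Relation.Binary.Permutation.Propositional using (_↭_; ↭-refl; ↭-sym; ↭-trans; ↭-prep; ↭-swap; ↭⇒↭ₛ)
open import Data.List.Relation.Binary.Permutation.Propositional.Properties using (All-resp-↭; ∈-resp-↭; ↭-length)
import Data.List.Relation.Binary.Permutation.Setoid.Properties as PermutationSetoid
open import Data.List.Relation.Unary.All as All using (All; []; _∷_)
import Data.List.Relation.Unary.All.Properties as All
open import Data.List.Relation.Unary.AllPairs as AllPairs using (AllPairs; []; _∷_)
import Data.List.Relation.Unary.AllPairs.Properties as AllPairs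
open import Data.List.Relation.Unary.Any using (here; there)
open import Data.List.Relation.Unary.Unique.Propositional using (Unique)
import Data.List.Relation.Unary.Unique.Propositional.Properties as Unique
open import Data.Nat using (ℕ; zero; suc; _+_; _*_; _/_; _<_; _≤_; _<?_; _<ᵇ_; _≡ᵇ_; s≤s; z<s; s<s)
open import Data.Nat.Combinatorics using (_C_; nCk+nC[k+1]≡[n+1]C[k+1]; nCk≡nC[n∸k]; nC1≡n)
open import Data.Nat.DivMod using (m*n/n≡m)
open import Data.Nat.Properties
open import Algebra.Properties.CommutativeSemigroup +-commutativeSemigroup using (interchange)
open import Data.Nat.Solver using (module +-*-Solver)
open import Data.Product using (Σ; _×_; _,_; proj₁; proj₂; map₁; map₂; ∃; ∃₂)
open import Data.Sum using (inj₁; inj₂)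
open import Function using (_∘_)
open import Function.Bundles using (_⇔_; mk⇔)
open import Relation.Binary.PropositionalEquality
open import Relation.Nullary using (contradiction; ofʸ; ofⁿ)

open +-*-Solver using (solve; _:=_; _:+_; _:*_; con)

<ᵇ-true : ∀ {m n} → m < n → (m <ᵇ n) ≡ true
<ᵇ-true {m} {n} m<n with m <ᵇ n | <ᵇ-reflects-< m n
... | true  | _        = refl
... | false | ofⁿ m≮n = contradiction m<n m≮n

<ᵇ-false : ∀ {m n} → n ≤ m → (m <ᵇ n) ≡ false
<ᵇ-false {m} {n} n≤m with m <ᵇ n | <ᵇ-reflects-< m n
... | false | _        = refl
... | true  | ofʸ m<n = contradiction n≤m (<⇒≱ m<n)

≡ᵇ-refl : ∀ n → (n ≡ᵇ n) ≡ true
≡ᵇ-refl zero    = refl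
≡ᵇ-refl (suc n) = ≡ᵇ-refl n

≡ᵇ-false : ∀ {m n} → m ≢ n → (m ≡ᵇ n) ≡ false
≡ᵇ-false {m} {n} m≢n with m ≡ᵇ n in eq
... | false = refl
... | true  = contradiction (≡ᵇ⇒≡ m n (subst T (sym eq) _)) m≢n

-- Queuesort from left to right

-- Queuesort continued from a current maximum m.  q moves the maxima right-to-left, and a
-- maximum never passes a larger one, so y may be bubbled after the suffix has been sorted.
qFrom : ℕ → List ℕ → List ℕ
qFrom m []       = []
qFrom m (y ∷ ys) = if m <ᵇ y then bubble y (qFrom y ys) else y ∷ qFrom m ys

ltrMaxGo-above : ∀ m ys → All (m <_) (ltrMaxGo m ys)
ltrMaxGo-above m []       = []
ltrMaxGo-above m (y ∷ ys) with m <ᵇ y | <ᵇ-reflects-< m y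
... | true  | ofʸ m<y = m<y ∷ All.map (<-trans m<y) (ltrMaxGo-above y ys)
... | false | _       = ltrMaxGo-above m ys

moveVals-skip : ∀ {y} ys {vs} → All (y <_) vs → foldr moveVal (y ∷ ys) vs ≡ y ∷ foldr moveVal ys vs
moveVals-skip ys []           = refl
moveVals-skip ys (y<v ∷ y<vs) rewrite moveVals-skip ys y<vs | ≡ᵇ-false (<⇒≢ y<v) = refl

moveVal-head : ∀ y ys → moveVal y (y ∷ ys) ≡ bubble y ys
moveVal-head y ys rewrite ≡ᵇ-refl y = refl

moveVals≡qFrom : ∀ m ys → foldr moveVal ys (ltrMaxGo m ys) ≡ qFrom m ys
moveVals≡qFrom m []       = refl
moveVals≡qFrom m (y ∷ ys) with m <ᵇ y | <ᵇ-reflects-< m y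
... | true  | _ = begin
  moveVal y (foldr moveVal (y ∷ ys) (ltrMaxGo y ys)) ≡⟨ cong (moveVal y) (moveVals-skip ys (ltrMaxGo-above y ys)) ⟩
  moveVal y (y ∷ foldr moveVal ys (ltrMaxGo y ys))   ≡⟨ moveVal-head y (foldr moveVal ys (ltrMaxGo y ys)) ⟩
  bubble y (foldr moveVal ys (ltrMaxGo y ys))         ≡⟨ cong (bubble y) (moveVals≡qFrom y ys) ⟩
  bubble y (qFrom y ys)                               ∎
  where open ≡-Reasoning
... | false | ofⁿ m≮y = trans (moveVals-skip ys (All.map (≤-<-trans (≮⇒≥ m≮y)) (ltrMaxGo-above m ys)))
                              (cong (y ∷_) (moveVals≡qFrom m ys))

q≡qFrom : ∀ σ → q σ ≡ qFrom 0 σ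
q≡qFrom = moveVals≡qFrom 0

bubble-↭ : ∀ y u → bubble y u ↭ y ∷ u
bubble-↭ y []       = ↭-refl
bubble-↭ y (z ∷ zs) with z <ᵇ y
... | true  = ↭-trans (↭-prep z (bubble-↭ y zs)) (↭-swap z y ↭-refl)
... | false = ↭-refl

qFrom-↭ : ∀ m σ → qFrom m σ ↭ σ
qFrom-↭ m []       = ↭-refl
qFrom-↭ m (y ∷ ys) with m <ᵇ y
... | true  = ↭-trans (bubble-↭ y (qFrom y ys)) (↭-prep y (qFrom-↭ y ys))
... | false = ↭-prep y (qFrom-↭ m ys)

-- Undoing a bubble

above : ℕ → List (ℕ × List ℕ) → List (ℕ × List ℕ)
above m = filter (λ c → m <? proj₁ c)

unmoved : ℕ → List ℕ → List (ℕ × List ℕ)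
unmoved x []      = (x , []) ∷ []
unmoved x (z ∷ t) = if z <ᵇ x then [] else (x , z ∷ t) ∷ []

-- Undoing bubble: y either stayed in front of t, or it passed the head x of t, which is then smaller.
unbubble : List ℕ → List (ℕ × List ℕ)
unbubble []      = []
unbubble (x ∷ t) = unmoved x t ++ map (map₂ (x ∷_)) (above x (unbubble t))

unmoved-≤ : ∀ {x z} t → x ≤ z → unmoved x (z ∷ t) ≡ (x , z ∷ t) ∷ []
unmoved-≤ t x≤z rewrite <ᵇ-false x≤z = refl

∈-unmoved⁻ : ∀ {c x} t → c ∈ unmoved x t → c ≡ (x , t) × bubble x t ≡ x ∷ t
∈-unmoved⁻ []                   (here refl) = refl , refl
∈-unmoved⁻ {x = x} (z ∷ t) c∈ with z <ᵇ x
∈-unmoved⁻         (z ∷ t) (here refl) | false = refl , refl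

unmoved-unique : ∀ x t → Unique (unmoved x t)
unmoved-unique x []      = [] ∷ []
unmoved-unique x (z ∷ t) with z <ᵇ x
... | true  = []
... | false = [] ∷ []

∈-unbubble⁻ : ∀ t {y u} → (y , u) ∈ unbubble t → bubble y u ≡ t
∈-unbubble⁻ (x ∷ t) c∈ with ∈-++⁻ (unmoved x t) c∈
... | inj₁ c∈unmoved with ∈-unmoved⁻ t c∈unmoved
...   | refl , stays = stays
∈-unbubble⁻ (x ∷ t) c∈ | inj₂ c∈moved with ∈-map⁻ (map₂ (x ∷_)) c∈moved
...   | (y , u) , c∈above , refl with ∈-filter⁻ (λ c → x <? proj₁ c) c∈above
...     | c∈unbubble , x<y rewrite <ᵇ-true x<y = cong (x ∷_) (∈-unbubble⁻ t c∈unbubble)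

∈-unbubble⁺ : ∀ y u → (y , u) ∈ unbubble (bubble y u)
∈-unbubble⁺ y []       = here refl
∈-unbubble⁺ y (z ∷ zs) with z <ᵇ y | <ᵇ-reflects-< z y
... | true  | ofʸ z<y = ∈-++⁺ʳ (unmoved z (bubble y zs))
                          (∈-map⁺ (map₂ (z ∷_)) (∈-filter⁺ (λ c → z <? proj₁ c) (∈-unbubble⁺ y zs) z<y))
... | false | ofⁿ z≮y = ∈-++⁺ˡ (subst ((y , z ∷ zs) ∈_) (sym (unmoved-≤ zs (≮⇒≥ z≮y))) (here refl))

∈-unbubble-fst : ∀ t {c} → c ∈ unbubble t → proj₁ c ∈ t
∈-unbubble-fst t {y , u} c∈ = subst (y ∈_) (∈-unbubble⁻ t c∈) (∈-resp-↭ (↭-sym (bubble-↭ y u)) (here refl))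

map₂-∷-injective : ∀ {x} {c c′ : ℕ × List ℕ} → map₂ (x ∷_) c ≡ map₂ (x ∷_) c′ → c ≡ c′
map₂-∷-injective {c = _ , _} {_ , _} refl = refl

unbubble-unique : ∀ t → Unique (unbubble t)
unbubble-unique []      = []
unbubble-unique (x ∷ t) =
  Unique.++⁺ (unmoved-unique x t)
             (Unique.map⁺ map₂-∷-injective (Unique.filter⁺ (λ c → x <? proj₁ c) (unbubble-unique t)))
             disjoint
  where
  disjoint : Disjoint (unmoved x t) (map (map₂ (x ∷_)) (above x (unbubble t)))
  disjoint (c∈unmoved , c∈moved) with ∈-map⁻ (map₂ (x ∷_)) c∈moved
  ... | c′ , c′∈above , refl =
    <-irrefl (sym (cong proj₁ (proj₁ (∈-unmoved⁻ t c∈unmoved))))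
             (proj₂ (∈-filter⁻ (λ c → x <? proj₁ c) {xs = unbubble t} c′∈above))

-- Preimages under Queuesort

-- Preimages under qFrom m, split by whether the first entry stays in front (it is not a new
-- maximum) or is a new maximum y bubbled into qFrom y of the rest.  The fuel f bounds the length
-- of the preimages found: the recursion on the un-bubbled remainder is not structural.
mutual
  qFrom⁻¹ : ℕ → ℕ → List ℕ → List (List ℕ)
  qFrom⁻¹ _       m []      = [] ∷ []
  qFrom⁻¹ zero    m (_ ∷ _) = []
  qFrom⁻¹ (suc f) m (x ∷ t) = headStays f m x t ++ headBubbles f (above m (unbubble (x ∷ t)))

  headStays : ℕ → ℕ → ℕ → List ℕ → List (List ℕ)
  headStays f m x t = if m <ᵇ x then [] else map (x ∷_) (qFrom⁻¹ f m t)

  headBubbles : ℕ → List (ℕ × List ℕ) → List (List ℕ)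
  headBubbles f []             = []
  headBubbles f ((y , u) ∷ cs) = map (y ∷_) (qFrom⁻¹ f y u) ++ headBubbles f cs

∈-headStays⁻ : ∀ f m x t {σ} → σ ∈ headStays f m x t →
               x ≤ m × ∃ λ σ′ → σ ≡ x ∷ σ′ × σ′ ∈ qFrom⁻¹ f m t
∈-headStays⁻ f m x t σ∈ with m <ᵇ x | <ᵇ-reflects-< m x
∈-headStays⁻ f m x t () | true  | _
∈-headStays⁻ f m x t σ∈ | false | ofⁿ m≮x with ∈-map⁻ (x ∷_) σ∈
... | σ′ , σ′∈ , refl = ≮⇒≥ m≮x , σ′ , refl , σ′∈

∈-headStays⁺ : ∀ f {m x t σ} → x ≤ m → σ ∈ qFrom⁻¹ f m t → x ∷ σ ∈ headStays f m x t
∈-headStays⁺ f {x = x} x≤m σ∈ rewrite <ᵇ-false x≤m = ∈-map⁺ (x ∷_) σ∈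

∈-headBubbles⁺ : ∀ f {cs y u σ} → (y , u) ∈ cs → σ ∈ qFrom⁻¹ f y u → y ∷ σ ∈ headBubbles f cs
∈-headBubbles⁺ f {(y , u) ∷ cs} (here refl) σ∈ = ∈-++⁺ˡ (∈-map⁺ (y ∷_) σ∈)
∈-headBubbles⁺ f {(y , u) ∷ cs} (there c∈) σ∈ = ∈-++⁺ʳ (map (y ∷_) (qFrom⁻¹ f y u)) (∈-headBubbles⁺ f c∈ σ∈)

mutual
  qFrom⁻¹-sound : ∀ f m t {σ} → σ ∈ qFrom⁻¹ f m t → qFrom m σ ≡ t
  qFrom⁻¹-sound f       m []      (here refl) = refl
  qFrom⁻¹-sound (suc f) m (x ∷ t) σ∈ with ∈-++⁻ (headStays f m x t) σ∈
  ... | inj₁ σ∈stays with ∈-headStays⁻ f m x t σ∈stays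
  ...   | x≤m , σ′ , refl , σ′∈ rewrite <ᵇ-false x≤m = cong (x ∷_) (qFrom⁻¹-sound f m t σ′∈)
  qFrom⁻¹-sound (suc f) m (x ∷ t) σ∈ | inj₂ σ∈bubbles with ∈-headBubbles⁻ f {above m (unbubble (x ∷ t))} σ∈bubbles
  ... | y , σ′ , refl , c∈ with ∈-filter⁻ (λ c → m <? proj₁ c) {xs = unbubble (x ∷ t)} c∈
  ...   | c∈unbubble , m<y rewrite <ᵇ-true m<y = ∈-unbubble⁻ (x ∷ t) c∈unbubble

  ∈-headBubbles⁻ : ∀ f {cs σ} → σ ∈ headBubbles f cs → ∃₂ λ y σ′ → σ ≡ y ∷ σ′ × (y , qFrom y σ′) ∈ cs
  ∈-headBubbles⁻ f {(y , u) ∷ cs} σ∈ with ∈-++⁻ (map (y ∷_) (qFrom⁻¹ f y u)) σ∈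
  ... | inj₁ σ∈here with ∈-map⁻ (y ∷_) σ∈here
  ...   | σ′ , σ′∈ , refl = y , σ′ , refl , here (cong (y ,_) (qFrom⁻¹-sound f y u σ′∈))
  ∈-headBubbles⁻ f {c ∷ cs} σ∈ | inj₂ σ∈rest with ∈-headBubbles⁻ f σ∈rest
  ... | y , σ′ , eq , c∈ = y , σ′ , eq , there c∈

qFrom⁻¹-complete : ∀ f m σ → length σ ≤ f → σ ∈ qFrom⁻¹ f m (qFrom m σ)
qFrom⁻¹-complete f       m []      _           = here refl
qFrom⁻¹-complete (suc f) m (y ∷ σ) (s≤s σ≤f) with m <ᵇ y | <ᵇ-reflects-< m y
... | true  | ofʸ m<y = bubbles (bubble y (qFrom y σ)) (∈-filter⁺ (λ c → m <? proj₁ c) (∈-unbubble⁺ y (qFrom y σ)) m<y)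
  where
  bubbles : ∀ t → (y , qFrom y σ) ∈ above m (unbubble t) → y ∷ σ ∈ qFrom⁻¹ (suc f) m t
  bubbles (x ∷ t) c∈ = ∈-++⁺ʳ (headStays f m x t) (∈-headBubbles⁺ f c∈ (qFrom⁻¹-complete f y σ σ≤f))
... | false | ofⁿ m≮y = ∈-++⁺ˡ (∈-headStays⁺ f {t = qFrom m σ} (≮⇒≥ m≮y) (qFrom⁻¹-complete f m σ σ≤f))

mutual
  qFrom⁻¹-unique : ∀ f m t → Unique (qFrom⁻¹ f m t)
  qFrom⁻¹-unique f       m []      = [] ∷ []
  qFrom⁻¹-unique zero    m (x ∷ t) = []
  qFrom⁻¹-unique (suc f) m (x ∷ t) =
    Unique.++⁺ (headStays-unique f m x t)
               (headBubbles-unique f (Unique.filter⁺ (λ c → m <? proj₁ c) (unbubble-unique (x ∷ t))))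
               disjoint
    where
    disjoint : Disjoint (headStays f m x t) (headBubbles f (above m (unbubble (x ∷ t))))
    disjoint (σ∈stays , σ∈bubbles)
      with ∈-headStays⁻ f m x t σ∈stays | ∈-headBubbles⁻ f {above m (unbubble (x ∷ t))} σ∈bubbles
    ... | x≤m , _ , refl , _ | y , _ , eq , c∈ =
      ≤⇒≯ x≤m (subst (m <_) (sym (∷-injectiveˡ eq))
                     (proj₂ (∈-filter⁻ (λ c → m <? proj₁ c) {xs = unbubble (x ∷ t)} c∈)))

  headStays-unique : ∀ f m x t → Unique (headStays f m x t)
  headStays-unique f m x t with m <ᵇ x
  ... | true  = []
  ... | false = Unique.map⁺ ∷-injectiveʳ (qFrom⁻¹-unique f m t)

  headBubbles-unique : ∀ f {cs} → Unique cs → Unique (headBubbles f cs)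
  headBubbles-unique f {[]}           []            = []
  headBubbles-unique f {(y , u) ∷ cs} (c∉cs ∷ cs!) =
    Unique.++⁺ (Unique.map⁺ ∷-injectiveʳ (qFrom⁻¹-unique f y u)) (headBubbles-unique f cs!) disjoint
    where
    disjoint : Disjoint (map (y ∷_) (qFrom⁻¹ f y u)) (headBubbles f cs)
    disjoint (σ∈here , σ∈rest) with ∈-map⁻ (y ∷_) σ∈here
    ... | σ′ , σ′∈ , refl with ∈-headBubbles⁻ f σ∈rest
    ...   | _ , _ , eq , c∈cs with ∷-injective eq
    ...     | refl , refl = All.lookup c∉cs (subst (λ v → (y , v) ∈ cs) (qFrom⁻¹-sound f y u σ′∈) c∈cs) refl

qFrom⁻¹-below : ∀ f m t → All (_≤ m) t → length t ≤ f → qFrom⁻¹ f m t ≡ t ∷ []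
qFrom⁻¹-below f       m []      _              _           = refl
qFrom⁻¹-below (suc f) m (x ∷ t) t≤m@(x≤m ∷ _) (s≤s t≤f) = cong₂ _++_ stays bubbles
  where
  stays : headStays f m x t ≡ (x ∷ t) ∷ []
  stays rewrite <ᵇ-false x≤m | qFrom⁻¹-below f m t (All.tail t≤m) t≤f = refl
  bubbles : headBubbles f (above m (unbubble (x ∷ t))) ≡ []
  bubbles = cong (headBubbles f) (filter-none (λ c → m <? proj₁ c)
              (All.tabulate λ c∈ → ≤⇒≯ (All.lookup t≤m (∈-unbubble-fst (x ∷ t) c∈))))

qFrom⁻¹-bubbling : ∀ f {m x t} → m < x → qFrom⁻¹ (suc f) m (x ∷ t) ≡ headBubbles f (above m (unbubble (x ∷ t)))
qFrom⁻¹-bubbling f m<x rewrite <ᵇ-true m<x = refl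

length-qFrom⁻¹-stays : ∀ f {m x t} → x ≤ m →
  length (qFrom⁻¹ (suc f) m (x ∷ t)) ≡ length (qFrom⁻¹ f m t) + length (headBubbles f (above m (unbubble (x ∷ t))))
length-qFrom⁻¹-stays f {m} {x} {t} x≤m rewrite <ᵇ-false x≤m =
  trans (length-++ (map (x ∷_) (qFrom⁻¹ f m t)))
        (cong (_+ length (headBubbles f (above m (unbubble (x ∷ t))))) (length-map (x ∷_) (qFrom⁻¹ f m t)))

length-headBubbles-∷ : ∀ f y u cs →
  length (headBubbles f ((y , u) ∷ cs)) ≡ length (qFrom⁻¹ f y u) + length (headBubbles f cs)
length-headBubbles-∷ f y u cs =
  trans (length-++ (map (y ∷_) (qFrom⁻¹ f y u))) (cong (_+ length (headBubbles f cs)) (length-map (y ∷_) (qFrom⁻¹ f y u)))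

qFrom⁻¹-fibre : ∀ {n π} → IsPerm n π → ∀ σ → σ ∈ qFrom⁻¹ (length π) 0 π ⇔ (IsPerm n σ × q σ ≡ π)
qFrom⁻¹-fibre {n} {π} π↭ σ = mk⇔ to from
  where
  to : σ ∈ qFrom⁻¹ (length π) 0 π → IsPerm n σ × q σ ≡ π
  to σ∈ = ↭-trans (↭-sym (qFrom-↭ 0 σ)) (subst (_↭ applyUpTo suc n) (sym qFromσ≡π) π↭) , trans (q≡qFrom σ) qFromσ≡π
    where qFromσ≡π = qFrom⁻¹-sound (length π) 0 π σ∈
  from : IsPerm n σ × q σ ≡ π → σ ∈ qFrom⁻¹ (length π) 0 π
  from (_ , qσ≡π) = subst (λ t → σ ∈ qFrom⁻¹ (length t) 0 t) (trans (sym (q≡qFrom σ)) qσ≡π)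
                          (qFrom⁻¹-complete _ 0 σ (≤-reflexive (↭-length (↭-sym (qFrom-↭ 0 σ)))))

-- Ballot and Catalan numbers

-- For x ≤ y, ballot x y counts the words with x letters a and y letters b in which no
-- prefix has more a's than b's (classify by the last letter).
ballot : ℕ → ℕ → ℕ
ballot zero    y       = 1
ballot (suc x) zero    = 0
ballot (suc x) (suc y) = ballot x (suc y) + (if x <ᵇ y then ballot (suc x) y else 0)

ballot-diagonal : ∀ x → ballot (suc x) (suc x) ≡ ballot x (suc x)
ballot-diagonal x rewrite <ᵇ-false (≤-refl {x}) = +-identityʳ _

ballot-step : ∀ {x y} → x ≤ y → ballot (suc x) (suc y) + ballot x (suc (suc y)) ≡ ballot (suc x) (suc (suc y))
ballot-step {x} {y} x≤y rewrite <ᵇ-true (s≤s x≤y) = +-comm (ballot (suc x) (suc y)) (ballot x (suc (suc y)))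

-- n C (k ∸ 1), except that it vanishes at k = 0, where truncated subtraction would give n C 0.
Cpred : ℕ → ℕ → ℕ
Cpred n zero    = 0
Cpred n (suc k) = n C k

pascal : ∀ n k → suc n C k ≡ Cpred n k + n C k
pascal n zero    = refl
pascal n (suc k) = sym (nCk+nC[k+1]≡[n+1]C[k+1] n k)

C-symmetric : ∀ a b → (a + b) C a ≡ (a + b) C b
C-symmetric a b = trans (nCk≡nC[n∸k] (m≤m+n a b)) (cong ((a + b) C_) (m+n∸m≡n a b))

-- The ballot formula C(x+y, x) − C(x+y, x−1), with the subtraction moved to the left.
ballot-closed : ∀ x y → x ≤ y → ballot x y + Cpred (x + y) x ≡ (x + y) C x
ballot-closed zero    y       _         = refl
ballot-closed (suc x) (suc y) (s≤s x≤y) with x <ᵇ y | <ᵇ-reflects-< x y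
... | true  | ofʸ x<y = begin
    ballot x (suc y) + ballot (suc x) y + suc N C x
      ≡⟨ cong (ballot x (suc y) + ballot (suc x) y +_) (pascal N x) ⟩
    ballot x (suc y) + ballot (suc x) y + (Cpred N x + N C x)
      ≡⟨ interchange (ballot x (suc y)) _ _ _ ⟩
    (ballot x (suc y) + Cpred N x) + (ballot (suc x) y + N C x)
      ≡⟨ cong₂ _+_ (ballot-closed x (suc y) (m≤n⇒m≤1+n x≤y)) shifted ⟩
    N C x + N C suc x
      ≡⟨ nCk+nC[k+1]≡[n+1]C[k+1] N x ⟩
    suc N C suc x ∎
  where
  open ≡-Reasoning
  N = x + suc y
  shifted : ballot (suc x) y + N C x ≡ N C suc x
  shifted = subst (λ M → ballot (suc x) y + M C x ≡ M C suc x) (sym (+-suc x y)) (ballot-closed (suc x) y x<y)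
... | false | ofⁿ x≮y = begin
    ballot x (suc y) + 0 + suc N C x           ≡⟨ cong₂ _+_ (+-identityʳ (ballot x (suc y))) (pascal N x) ⟩
    ballot x (suc y) + (Cpred N x + N C x)     ≡⟨ sym (+-assoc (ballot x (suc y)) _ _) ⟩
    ballot x (suc y) + Cpred N x + N C x       ≡⟨ cong₂ _+_ (ballot-closed x (suc y) (m≤n⇒m≤1+n x≤y)) middle ⟩
    N C x + N C suc x                          ≡⟨ nCk+nC[k+1]≡[n+1]C[k+1] N x ⟩
    suc N C suc x                              ∎
  where
  open ≡-Reasoning
  N = x + suc y
  middle : N C x ≡ N C suc x
  middle rewrite sym (≤-antisym x≤y (≮⇒≥ x≮y)) = C-symmetric x (suc x)

-- (k + 1) C(n, k + 1) = (n − k) C(n, k), with the subtraction moved to the left.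
C-absorption : ∀ n k → suc k * (n C suc k) + k * (n C k) ≡ n * (n C k)
C-absorption zero    zero    = refl
C-absorption zero    (suc k) = cong₂ _+_ (*-zeroʳ (suc (suc k))) (*-zeroʳ (suc k))
C-absorption (suc n) zero    = begin
  1 * (suc n C 1) + 0 ≡⟨ +-identityʳ _ ⟩
  1 * (suc n C 1)     ≡⟨ *-identityˡ _ ⟩
  suc n C 1           ≡⟨ nC1≡n (suc n) ⟩
  suc n               ≡⟨ *-identityʳ (suc n) ⟨
  suc n * 1           ∎
  where open ≡-Reasoning
C-absorption (suc n) (suc k) = begin
  suc (suc k) * (suc n C suc (suc k)) + suc k * (suc n C suc k)
    ≡⟨ cong₂ (λ u v → suc (suc k) * u + suc k * v) (pascal n (suc (suc k))) (pascal n (suc k)) ⟩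
  suc (suc k) * (b₁ + b₂) + suc k * (b₀ + b₁)
    ≡⟨ regroup k b₀ b₁ b₂ ⟩
  (suc (suc k) * b₂ + suc k * b₁) + (suc k * b₁ + k * b₀) + (b₀ + b₁)
    ≡⟨ cong₂ (λ u v → u + v + (b₀ + b₁)) (C-absorption n (suc k)) (C-absorption n k) ⟩
  n * b₁ + n * b₀ + (b₀ + b₁)
    ≡⟨ collect n b₀ b₁ ⟩
  suc n * (b₀ + b₁)
    ≡⟨ cong (suc n *_) (pascal n (suc k)) ⟨
  suc n * (suc n C suc k) ∎
  where
  open ≡-Reasoning
  b₀ = n C k
  b₁ = n C suc k
  b₂ = n C suc (suc k)
  regroup : ∀ k b₀ b₁ b₂ → suc (suc k) * (b₁ + b₂) + suc k * (b₀ + b₁)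
                          ≡ (suc (suc k) * b₂ + suc k * b₁) + (suc k * b₁ + k * b₀) + (b₀ + b₁)
  regroup = solve 4 (λ k b₀ b₁ b₂ → (con 2 :+ k) :* (b₁ :+ b₂) :+ (con 1 :+ k) :* (b₀ :+ b₁)
                    := ((con 2 :+ k) :* b₂ :+ (con 1 :+ k) :* b₁) :+ ((con 1 :+ k) :* b₁ :+ k :* b₀) :+ (b₀ :+ b₁)) refl
  collect : ∀ n b₀ b₁ → n * b₁ + n * b₀ + (b₀ + b₁) ≡ suc n * (b₀ + b₁)
  collect = solve 3 (λ n b₀ b₁ → n :* b₁ :+ n :* b₀ :+ (b₀ :+ b₁) := (con 1 :+ n) :* (b₀ :+ b₁)) refl

central-Cpred : ∀ k → suc k * Cpred (k + k) k ≡ k * ((k + k) C k)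
central-Cpred zero    = refl
central-Cpred (suc j) = +-cancelʳ-≡ (suc j * b₁) _ _ (begin
  suc (suc j) * (N C j) + suc j * b₁             ≡⟨ cong (λ v → suc (suc j) * v + suc j * b₁) mirror ⟩
  suc (suc j) * (N C suc (suc j)) + suc j * b₁   ≡⟨ C-absorption N (suc j) ⟩
  N * b₁                                         ≡⟨ *-distribʳ-+ b₁ (suc j) (suc j) ⟩
  suc j * b₁ + suc j * b₁                        ∎)
  where
  open ≡-Reasoning
  N = suc j + suc j
  b₁ = N C suc j
  mirror : N C j ≡ N C suc (suc j)
  mirror = subst (λ M → M C j ≡ M C suc (suc j)) (cong suc (sym (+-suc j j))) (sym (C-symmetric (suc (suc j)) j))

catalan≡ballot : ∀ k → catalan k ≡ ballot k k
catalan≡ballot k = begin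
  ((2 * k) C k) / suc k          ≡⟨ cong (λ M → (M C k) / suc k) (cong (k +_) (+-identityʳ k)) ⟩
  ((k + k) C k) / suc k          ≡⟨ cong (_/ suc k) (+-cancelʳ-≡ (k * B) _ _ central) ⟨
  (suc k * ballot k k) / suc k   ≡⟨ cong (_/ suc k) (*-comm (suc k) (ballot k k)) ⟩
  (ballot k k * suc k) / suc k   ≡⟨ m*n/n≡m (ballot k k) (suc k) ⟩
  ballot k k                     ∎
  where
  open ≡-Reasoning
  B = (k + k) C k
  central : suc k * ballot k k + k * B ≡ B + k * B
  central = begin
    suc k * ballot k k + k * B                      ≡⟨ cong (suc k * ballot k k +_) (central-Cpred k) ⟨
    suc k * ballot k k + suc k * Cpred (k + k) k    ≡⟨ *-distribˡ-+ (suc k) (ballot k k) _ ⟨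
    suc k * (ballot k k + Cpred (k + k) k)          ≡⟨ cong (suc k *_) (ballot-closed k k ≤-refl) ⟩
    suc k * B                                       ∎

-- The left-to-right maxima of π

AllPairs-++⁻ : ∀ {A : Set} {R : A → A → Set} xs {ys} → AllPairs R (xs ++ ys) →
               AllPairs R xs × AllPairs R ys × All (λ x → All (R x) ys) xs
AllPairs-++⁻ []       xs∼ys        = [] , xs∼ys , []
AllPairs-++⁻ (x ∷ xs) (x∼ ∷ xs∼ys) with AllPairs-++⁻ xs xs∼ys
... | xs! , ys! , xs∼ys′ = All.++⁻ˡ xs x∼ ∷ xs! , ys! , All.++⁻ʳ xs x∼ ∷ xs∼ys′

∉-Unique-++ : ∀ {A : Set} (xs : List A) {y ys} → Unique (xs ++ y ∷ ys) → y ∉ xs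
∉-Unique-++ xs xs! y∈xs = All.head (All.lookup (proj₂ (proj₂ (AllPairs-++⁻ xs xs!))) y∈xs) refl

≤-∉⇒< : ∀ {a xs} → All (_≤ a) xs → a ∉ xs → All (_< a) xs
≤-∉⇒< []           _  = []
≤-∉⇒< (x≤a ∷ xs≤a) a∉ = ≤∧≢⇒< x≤a (λ x≡a → a∉ (here (sym x≡a))) ∷ ≤-∉⇒< xs≤a (a∉ ∘ there)

ltrMaxGo-∷⁻ : ∀ c x ys {zs} → ltrMaxGo c (x ∷ ys) ≡ x ∷ zs → c < x × ltrMaxGo x ys ≡ zs
ltrMaxGo-∷⁻ c x ys eq with c <ᵇ x | <ᵇ-reflects-< c x
... | true  | ofʸ c<x = c<x , ∷-injectiveʳ eq
... | false | ofⁿ c≮x = contradiction (All.head (subst (All (c <_)) eq (ltrMaxGo-above c ys))) c≮x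

ltrMaxGo-increasing⁻ : ∀ c s a ys {zs} → ltrMaxGo c (s ++ a ∷ ys) ≡ s ++ a ∷ zs →
                       AllPairs _<_ (c ∷ s ++ a ∷ []) × ltrMaxGo a ys ≡ zs
ltrMaxGo-increasing⁻ c [] a ys eq with ltrMaxGo-∷⁻ c a ys eq
... | c<a , rest = (c<a ∷ []) ∷ [] ∷ [] , rest
ltrMaxGo-increasing⁻ c (x ∷ s) a ys eq with ltrMaxGo-∷⁻ c x (s ++ a ∷ ys) eq
... | c<x , eq′ with ltrMaxGo-increasing⁻ x s a ys eq′
...   | x<s∷a ∷ s∷a! , rest = (c<x ∷ All.map (<-trans c<x) x<s∷a) ∷ x<s∷a ∷ s∷a! , rest

ltrMaxGo-∷ʳ⁻ : ∀ c ys {n} → ltrMaxGo c (ys ++ n ∷ []) ≡ n ∷ [] → n ∉ ys → All (_≤ c) ys × c < n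
ltrMaxGo-∷ʳ⁻ c []       {n} eq _  = [] , proj₁ (ltrMaxGo-∷⁻ c n [] eq)
ltrMaxGo-∷ʳ⁻ c (y ∷ ys)     eq n∉ with c <ᵇ y | <ᵇ-reflects-< c y
... | true  | _        = contradiction (here (sym (∷-injectiveˡ eq))) n∉
... | false | ofⁿ c≮y = map₁ (≮⇒≥ c≮y ∷_) (ltrMaxGo-∷ʳ⁻ c ys eq (n∉ ∘ there))

ltr-decomposition : ∀ n M₁ P₁ → Unique (M₁ ++ P₁ ++ n ∷ []) → All (0 <_) (M₁ ++ P₁ ++ n ∷ []) → P₁ ≢ [] →
  ltrMaxima (M₁ ++ P₁ ++ n ∷ []) ≡ M₁ ++ n ∷ [] →
  ∃₂ λ s a → M₁ ≡ s ++ a ∷ [] × AllPairs _<_ (0 ∷ s ++ a ∷ []) × All (_< a) P₁ × a < n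
ltr-decomposition n M₁ [] _ _ P₁≢[] _ = contradiction refl P₁≢[]
ltr-decomposition n M₁ P₁@(_ ∷ _) π! π>0 _ ltr with initLast M₁
... | [] = contradiction (All.head (proj₁ (ltrMaxGo-∷ʳ⁻ 0 P₁ ltr (∉-Unique-++ P₁ π!)))) (<⇒≱ (All.head π>0))
... | s ∷ʳ′ a = s , a , refl , proj₁ split , ≤-∉⇒< (proj₁ P₁∷n-bounds) a∉P₁ , proj₂ P₁∷n-bounds
  where
  reassoc : ∀ zs → (s ++ a ∷ []) ++ zs ≡ s ++ a ∷ zs
  reassoc = ++-assoc s (a ∷ [])
  split = ltrMaxGo-increasing⁻ 0 s a (P₁ ++ n ∷ []) (trans (cong ltrMaxima (sym (reassoc _))) (trans ltr (reassoc _)))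
  a∷P₁∷n! : Unique (a ∷ P₁ ++ n ∷ [])
  a∷P₁∷n! = proj₁ (proj₂ (AllPairs-++⁻ s (subst Unique (reassoc _) π!)))
  a∉P₁ : a ∉ P₁
  a∉P₁ a∈P₁ = All.lookup (AllPairs.head a∷P₁∷n!) (∈-++⁺ˡ a∈P₁) refl
  P₁∷n-bounds : All (_≤ a) P₁ × a < n
  P₁∷n-bounds = ltrMaxGo-∷ʳ⁻ a P₁ (proj₂ split) (∉-Unique-++ P₁ (AllPairs.tail a∷P₁∷n!))

-- Counting the preimages of π

above-map₂ : ∀ m (g : List ℕ → List ℕ) cs → above m (map (map₂ g) cs) ≡ map (map₂ g) (above m cs)
above-map₂ m g []             = refl
above-map₂ m g ((y , u) ∷ cs) with m <ᵇ y
... | true  = cong ((y , g u) ∷_) (above-map₂ m g cs)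
... | false = above-map₂ m g cs

above-above : ∀ {x m} cs → x ≤ m → above m (above x cs) ≡ above m cs
above-above []             x≤m = refl
above-above {x} {m} ((y , u) ∷ cs) x≤m with x <ᵇ y | <ᵇ-reflects-< x y
... | true  | _ with m <ᵇ y
...   | true  = cong ((y , u) ∷_) (above-above cs x≤m)
...   | false = above-above cs x≤m
above-above {x} {m} ((y , u) ∷ cs) x≤m | false | ofⁿ x≮y rewrite <ᵇ-false (≤-trans (≮⇒≥ x≮y) x≤m) =
  above-above cs x≤m

above-unbubble-∷ʳ : ∀ {a n} Q → All (_< a) Q → a < n → above a (unbubble (Q ++ n ∷ [])) ≡ (n , Q) ∷ []
above-unbubble-∷ʳ         []      []           a<n rewrite <ᵇ-true a<n = refl
above-unbubble-∷ʳ {a} {n} (y ∷ Q) (y<a ∷ Q<a) a<n = begin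
  above a (unmoved y (Q ++ n ∷ []) ++ map (map₂ (y ∷_)) (above y U))
    ≡⟨ filter-++ (λ c → a <? proj₁ c) (unmoved y (Q ++ n ∷ [])) _ ⟩
  above a (unmoved y (Q ++ n ∷ [])) ++ above a (map (map₂ (y ∷_)) (above y U))
    ≡⟨ cong₂ _++_ unmoved-below (above-map₂ a (y ∷_) (above y U)) ⟩
  map (map₂ (y ∷_)) (above a (above y U))
    ≡⟨ cong (map (map₂ (y ∷_))) (trans (above-above U (<⇒≤ y<a)) (above-unbubble-∷ʳ Q Q<a a<n)) ⟩
  (n , y ∷ Q) ∷ [] ∎
  where
  open ≡-Reasoning
  U = unbubble (Q ++ n ∷ [])
  unmoved-below : above a (unmoved y (Q ++ n ∷ [])) ≡ []
  unmoved-below = filter-none (λ c → a <? proj₁ c) (All.tabulate λ c∈ a<c →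
    <-asym y<a (subst (a <_) (cong proj₁ (proj₁ (∈-unmoved⁻ (Q ++ n ∷ []) c∈))) a<c))

unbubble-peak : ∀ {a n} P → P ≢ [] → All (_< a) P → a < n → unbubble (a ∷ P ++ n ∷ []) ≡ (n , a ∷ P) ∷ []
unbubble-peak []      P≢[] _                _   = contradiction refl P≢[]
unbubble-peak {a} (z ∷ P) _ P<a@(z<a ∷ _) a<n rewrite <ᵇ-true z<a =
  cong (map (map₂ (a ∷_))) (above-unbubble-∷ʳ (z ∷ P) P<a a<n)

module Counting (a n : ℕ) (P : List ℕ) (P≢[] : P ≢ []) (P<a : All (_< a) P) (a<n : a < n) where

  tl : List ℕ
  tl = a ∷ P ++ n ∷ []

  Ascending : List ℕ → Set
  Ascending s = AllPairs _<_ s × All (_< a) s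

  ascending-split : ∀ p {x r} → Ascending (p ++ x ∷ r) → All (_≤ x) p × All (x <_) r × x < a × Ascending (p ++ r)
  ascending-split p (p∷x∷r! , p∷x∷r<a) with AllPairs-++⁻ p p∷x∷r!
  ... | p! , x<r ∷ r! , p<x∷r =
    All.map (<⇒≤ ∘ All.head) p<x∷r , x<r , All.head (All.++⁻ʳ p p∷x∷r<a) ,
    AllPairs.++⁺ p! r! (All.map All.tail p<x∷r) , All.++⁺ (All.++⁻ˡ p p∷x∷r<a) (All.tail (All.++⁻ʳ p p∷x∷r<a))

  -- The ways to un-bubble p ++ s ++ tl, for ascending p ++ s, in which the bubbled entry
  -- comes from s or is n.
  candidates : List ℕ → List ℕ → List (ℕ × List ℕ)
  candidates p []      = (n , p ++ a ∷ P) ∷ []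
  candidates p (x ∷ s) = (x , p ++ s ++ tl) ∷ candidates (p ++ x ∷ []) s

  map-candidates : ∀ x p s → map (map₂ (x ∷_)) (candidates p s) ≡ candidates (x ∷ p) s
  map-candidates x p []      = refl
  map-candidates x p (y ∷ s) = cong ((y , x ∷ p ++ s ++ tl) ∷_) (map-candidates x (p ++ y ∷ []) s)

  candidates-fst : ∀ {Q : ℕ → Set} p {s} → All Q s → Q n → All (Q ∘ proj₁) (candidates p s)
  candidates-fst p         []        Qn = Qn ∷ []
  candidates-fst p {x ∷ _} (Qx ∷ Qs) Qn = Qx ∷ candidates-fst (p ++ x ∷ []) Qs Qn

  unmoved-ascending : ∀ x s → All (x <_) s → x < a → unmoved x (s ++ tl) ≡ (x , s ++ tl) ∷ []
  unmoved-ascending x []      []          x<a = unmoved-≤ (P ++ n ∷ []) (<⇒≤ x<a)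
  unmoved-ascending x (y ∷ s) (x<y ∷ _)   _   = unmoved-≤ (s ++ tl) (<⇒≤ x<y)

  unbubble-ascending : ∀ s → Ascending s → unbubble (s ++ tl) ≡ candidates [] s
  unbubble-ascending []      _                      = unbubble-peak P P≢[] P<a a<n
  unbubble-ascending (x ∷ s) (x<s ∷ s! , x<a ∷ s<a) = begin
    unmoved x (s ++ tl) ++ map (map₂ (x ∷_)) (above x (unbubble (s ++ tl)))
      ≡⟨ cong₂ (λ u v → u ++ map (map₂ (x ∷_)) (above x v))
               (unmoved-ascending x s x<s x<a) (unbubble-ascending s (s! , s<a)) ⟩
    (x , s ++ tl) ∷ map (map₂ (x ∷_)) (above x (candidates [] s))
      ≡⟨ cong (λ cs → (x , s ++ tl) ∷ map (map₂ (x ∷_)) cs)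
              (filter-all (λ c → x <? proj₁ c) (candidates-fst [] x<s (<-trans x<a a<n))) ⟩
    (x , s ++ tl) ∷ map (map₂ (x ∷_)) (candidates [] s)
      ≡⟨ cong ((x , s ++ tl) ∷_) (map-candidates x [] s) ⟩
    candidates [] (x ∷ s) ∎
    where open ≡-Reasoning

  above-candidates-skip : ∀ {m} p l r → All (_≤ m) l → above m (candidates p (l ++ r)) ≡ above m (candidates (p ++ l) r)
  above-candidates-skip p []      r []          = cong (λ p′ → above _ (candidates p′ r)) (sym (++-identityʳ p))
  above-candidates-skip {m} p (x ∷ l) r (x≤m ∷ l≤m) = begin
    above m (candidates p (x ∷ l ++ r))          ≡⟨ filter-reject (λ c → m <? proj₁ c) (≤⇒≯ x≤m) ⟩
    above m (candidates (p ++ x ∷ []) (l ++ r))  ≡⟨ above-candidates-skip (p ++ x ∷ []) l r l≤m ⟩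
    above m (candidates ((p ++ x ∷ []) ++ l) r)  ≡⟨ cong (λ p′ → above m (candidates p′ r)) (++-assoc p (x ∷ []) l) ⟩
    above m (candidates (p ++ x ∷ l) r)          ∎
    where open ≡-Reasoning

  qFrom⁻¹-ascending : ∀ f {m} r → All (m <_) r → Ascending r → m < a →
                      qFrom⁻¹ (suc f) m (r ++ tl) ≡ headBubbles f (above m (candidates [] r))
  qFrom⁻¹-ascending f []      []        asc m<a =
    trans (qFrom⁻¹-bubbling f {t = P ++ n ∷ []} m<a) (cong (headBubbles f ∘ above _) (unbubble-ascending [] asc))
  qFrom⁻¹-ascending f (x ∷ r) (m<x ∷ _) asc _   =
    trans (qFrom⁻¹-bubbling f {t = r ++ tl} m<x) (cong (headBubbles f ∘ above _) (unbubble-ascending (x ∷ r) asc))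

  tl-nonempty : ∀ l r → 0 < length (l ++ r ++ tl)
  tl-nonempty (_ ∷ _) _       = z<s
  tl-nonempty []      (_ ∷ _) = z<s
  tl-nonempty []      []      = z<s

  length-tl : ∀ p → length (p ++ tl) ≡ suc (length (p ++ a ∷ P))
  length-tl p = begin
    length (p ++ a ∷ P ++ n ∷ [])   ≡⟨ cong length (++-assoc p (a ∷ P) (n ∷ [])) ⟨
    length ((p ++ a ∷ P) ++ n ∷ []) ≡⟨ length-++ (p ++ a ∷ P) ⟩
    length (p ++ a ∷ P) + 1         ≡⟨ +-comm _ 1 ⟩
    suc (length (p ++ a ∷ P))       ∎
    where open ≡-Reasoning

  length-≤-++ : ∀ (l r : List ℕ) → length r ≤ length (l ++ r)
  length-≤-++ l r = subst (length r ≤_) (sym (length-++ l)) (m≤n+m (length r) (length l))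

  mutual
    count-preimages : ∀ f {m} l r → All (_≤ m) l → All (m <_) r → Ascending (l ++ r) → m < a →
                      length (l ++ r ++ tl) ≤ f →
                      length (qFrom⁻¹ f m (l ++ r ++ tl)) ≡ ballot (suc (length r)) (suc (length (l ++ r)))
    count-preimages zero    l r _ _ _ _ l∷r∷tl≤0 = contradiction l∷r∷tl≤0 (<⇒≱ (tl-nonempty l r))
    count-preimages (suc f) {m} [] r [] m<r asc m<a r∷tl≤f = begin
      length (qFrom⁻¹ (suc f) m (r ++ tl))              ≡⟨ cong length (qFrom⁻¹-ascending f r m<r asc m<a) ⟩
      length (headBubbles f (above m (candidates [] r))) ≡⟨ count-candidates f [] r m<r asc m<a r∷tl≤f ⟩
      ballot (length r) (suc (length r))                 ≡⟨ ballot-diagonal (length r) ⟨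
      ballot (suc (length r)) (suc (length r))           ∎
      where open ≡-Reasoning
    count-preimages (suc f) {m} (x ∷ l) r (x≤m ∷ l≤m) m<r asc@(_ ∷ l∷r! , _ ∷ l∷r<a) m<a x∷l∷r∷tl≤f = begin
      length (qFrom⁻¹ (suc f) m (x ∷ l ++ r ++ tl))
        ≡⟨ length-qFrom⁻¹-stays f {t = l ++ r ++ tl} x≤m ⟩
      length (qFrom⁻¹ f m (l ++ r ++ tl)) + length (headBubbles f (above m (unbubble (x ∷ l ++ r ++ tl))))
        ≡⟨ cong₂ _+_ (count-preimages f l r l≤m m<r (l∷r! , l∷r<a) m<a (≤-pred x∷l∷r∷tl≤f)) bubbling ⟩
      ballot (suc (length r)) (suc (length (l ++ r))) + ballot (length r) (suc (suc (length (l ++ r))))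
        ≡⟨ ballot-step (length-≤-++ l r) ⟩
      ballot (suc (length r)) (suc (suc (length (l ++ r)))) ∎
      where
      open ≡-Reasoning
      bubbling : length (headBubbles f (above m (unbubble (x ∷ l ++ r ++ tl)))) ≡
                 ballot (length r) (suc (suc (length (l ++ r))))
      bubbling = begin
        length (headBubbles f (above m (unbubble (x ∷ l ++ r ++ tl))))
          ≡⟨ cong (λ t → length (headBubbles f (above m (unbubble (x ∷ t))))) (++-assoc l r tl) ⟨
        length (headBubbles f (above m (unbubble ((x ∷ l ++ r) ++ tl))))
          ≡⟨ cong (length ∘ headBubbles f ∘ above m) (unbubble-ascending (x ∷ l ++ r) asc) ⟩
        length (headBubbles f (above m (candidates [] (x ∷ l ++ r))))
          ≡⟨ cong (length ∘ headBubbles f) (above-candidates-skip [] (x ∷ l) r (x≤m ∷ l≤m)) ⟩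
        length (headBubbles f (above m (candidates (x ∷ l) r)))
          ≡⟨ count-candidates f (x ∷ l) r m<r asc m<a x∷l∷r∷tl≤f ⟩
        ballot (length r) (suc (suc (length (l ++ r)))) ∎

    count-candidates : ∀ f {m} p r → All (m <_) r → Ascending (p ++ r) → m < a → length (p ++ r ++ tl) ≤ suc f →
                       length (headBubbles f (above m (candidates p r))) ≡ ballot (length r) (suc (length (p ++ r)))
    count-candidates f {m} p [] [] (_ , p<a) m<a p∷tl≤f = begin
      length (headBubbles f (above m ((n , p ++ a ∷ P) ∷ [])))
        ≡⟨ cong (length ∘ headBubbles f) (filter-accept (λ c → m <? proj₁ c) (<-trans m<a a<n)) ⟩
      length (map (n ∷_) (qFrom⁻¹ f n (p ++ a ∷ P)) ++ [])
        ≡⟨ cong (λ ps → length (map (n ∷_) ps ++ [])) (qFrom⁻¹-below f n (p ++ a ∷ P) p∷a∷P≤n p∷a∷P≤f) ⟩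
      1 ∎
      where
      open ≡-Reasoning
      <a⇒≤n : ∀ {x} → x < a → x ≤ n
      <a⇒≤n x<a = <⇒≤ (<-trans x<a a<n)
      p∷a∷P≤n : All (_≤ n) (p ++ a ∷ P)
      p∷a∷P≤n = All.++⁺ (All.map <a⇒≤n (All.++⁻ˡ p p<a)) (<⇒≤ a<n ∷ All.map <a⇒≤n P<a)
      p∷a∷P≤f : length (p ++ a ∷ P) ≤ f
      p∷a∷P≤f = ≤-pred (subst (_≤ suc f) (length-tl p) p∷tl≤f)
    count-candidates f {m} p (x ∷ r) (m<x ∷ m<r) asc m<a p∷x∷r∷tl≤f with ascending-split p asc
    ... | p≤x , x<r , x<a , p∷r-asc = begin
      length (headBubbles f (above m (candidates p (x ∷ r))))
        ≡⟨ cong (length ∘ headBubbles f) (filter-accept (λ c → m <? proj₁ c) m<x) ⟩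
      length (headBubbles f ((x , p ++ r ++ tl) ∷ above m (candidates (p ++ x ∷ []) r)))
        ≡⟨ length-headBubbles-∷ f x (p ++ r ++ tl) (above m (candidates (p ++ x ∷ []) r)) ⟩
      length (qFrom⁻¹ f x (p ++ r ++ tl)) + length (headBubbles f (above m (candidates (p ++ x ∷ []) r)))
        ≡⟨ cong₂ _+_ (count-preimages f p r p≤x x<r p∷r-asc x<a p∷r∷tl≤f) shifted ⟩
      ballot (suc (length r)) (suc L) + ballot (length r) (suc (suc L))
        ≡⟨ ballot-step (length-≤-++ p r) ⟩
      ballot (suc (length r)) (suc (suc L))
        ≡⟨ cong (λ k → ballot (suc (length r)) (suc k)) (length-++-sucʳ p x r) ⟨
      ballot (suc (length r)) (suc (length (p ++ x ∷ r))) ∎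
      where
      open ≡-Reasoning
      L = length (p ++ r)
      shift : ∀ ys → (p ++ x ∷ []) ++ ys ≡ p ++ x ∷ ys
      shift = ++-assoc p (x ∷ [])
      p∷r∷tl≤f : length (p ++ r ++ tl) ≤ f
      p∷r∷tl≤f = ≤-pred (subst (_≤ suc f) (length-++-sucʳ p x (r ++ tl)) p∷x∷r∷tl≤f)
      shifted : length (headBubbles f (above m (candidates (p ++ x ∷ []) r))) ≡ ballot (length r) (suc (suc L))
      shifted = trans (count-candidates f (p ++ x ∷ []) r m<r (subst Ascending (sym (shift r)) asc) m<a
                                         (subst (_≤ suc f) (cong length (sym (shift (r ++ tl)))) p∷x∷r∷tl≤f))
                      (cong (λ k → ballot (length r) (suc k)) (trans (cong length (shift r)) (length-++-sucʳ p x r)))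

preimages-count : ∀ s a P n → P ≢ [] → AllPairs _<_ (0 ∷ s ++ a ∷ []) → All (_< a) P → a < n →
  length (qFrom⁻¹ (length (s ++ a ∷ P ++ n ∷ [])) 0 (s ++ a ∷ P ++ n ∷ [])) ≡ catalan (suc (length s))
preimages-count s a P n P≢[] (0<s∷a ∷ s∷a!) P<a a<n with AllPairs-++⁻ s s∷a!
... | s! , _ , s<a = begin
  length (qFrom⁻¹ (length (s ++ tl)) 0 (s ++ tl))
    ≡⟨ count-preimages (length (s ++ tl)) [] s [] (All.++⁻ˡ s 0<s∷a) (s! , All.map All.head s<a)
                       (All.head (All.++⁻ʳ s 0<s∷a)) ≤-refl ⟩
  ballot (suc (length s)) (suc (length s)) ≡⟨ catalan≡ballot (suc (length s)) ⟨
  catalan (suc (length s)) ∎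
  where
  open ≡-Reasoning
  open Counting a n P P≢[] P<a a<n

perm-unique : ∀ {n π} → IsPerm n π → Unique π
perm-unique {n} π↭ = PermutationSetoid.Unique-resp-↭ (setoid ℕ) (↭⇒↭ₛ (↭-sym π↭))
                       (Unique.applyUpTo⁺₁ suc n (λ i<j _ → <⇒≢ (s<s i<j)))

perm-positive : ∀ {n π} → IsPerm n π → All (0 <_) π
perm-positive {n} π↭ = All-resp-↭ (↭-sym π↭) (All.applyUpTo⁺₂ suc n (λ _ → z<s))

ltr-preimages-count : ∀ n M₁ P₁ → Unique (M₁ ++ P₁ ++ n ∷ []) → All (0 <_) (M₁ ++ P₁ ++ n ∷ []) → P₁ ≢ [] →
  ltrMaxima (M₁ ++ P₁ ++ n ∷ []) ≡ M₁ ++ n ∷ [] →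
  length (qFrom⁻¹ (length (M₁ ++ P₁ ++ n ∷ [])) 0 (M₁ ++ P₁ ++ n ∷ [])) ≡ catalan (length M₁)
ltr-preimages-count n M₁ P₁ π! π>0 P₁≢[] ltr with ltr-decomposition n M₁ P₁ π! π>0 P₁≢[] ltr
... | s , a , refl , s∷a-increasing , P₁<a , a<n = begin
  length (qFrom⁻¹ (length ((s ++ a ∷ []) ++ P₁ ++ n ∷ [])) 0 ((s ++ a ∷ []) ++ P₁ ++ n ∷ []))
    ≡⟨ cong (λ π → length (qFrom⁻¹ (length π) 0 π)) (++-assoc s (a ∷ []) (P₁ ++ n ∷ [])) ⟩
  length (qFrom⁻¹ (length (s ++ a ∷ P₁ ++ n ∷ [])) 0 (s ++ a ∷ P₁ ++ n ∷ []))
    ≡⟨ preimages-count s a P₁ n P₁≢[] s∷a-increasing P₁<a a<n ⟩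
  catalan (suc (length s))
    ≡⟨ cong catalan (trans (length-++ s) (+-comm (length s) 1)) ⟨
  catalan (length (s ++ a ∷ [])) ∎
  where open ≡-Reasoning

lemma4p9 : (n : ℕ) (π M₁ P₁ : List ℕ) → IsPerm n π →
    π ≡ M₁ ++ P₁ ++ (n ∷ []) → P₁ ≢ [] → ltrMaxima π ≡ M₁ ++ (n ∷ []) →
    Σ (List (List ℕ)) (λ L → Unique L × ((σ : List ℕ) → (σ ∈ L ⇔ (IsPerm n σ × q σ ≡ π))) × length L ≡ catalan (length M₁))
lemma4p9 n π M₁ P₁ π↭ refl P₁≢[] ltr =
  qFrom⁻¹ (length π) 0 π , qFrom⁻¹-unique (length π) 0 π , qFrom⁻¹-fibre π↭ ,
  ltr-preimages-count n M₁ P₁ (perm-unique π↭) (perm-positive π↭) P₁≢[] ltr
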